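{- Let $p=113$, $m=8$, $g=3$ (a primitive root modulo $113$), and for $0\le i<8$ let $X_i=\{g^{8\alpha+i} \bmod 113 : 0\le \alpha<14\}\subseteq \mathbb{Z}/113\mathbb{Z}$. Put $A=X_1\cup X_2\cup X_3\cup X_4\cup X_5$, $B=X_0$, $C=X_6\cup X_7$. Then $A+A=\mathbb{Z}/p\mathbb{Z}$, $A+B=(\mathbb{Z}/p\mathbb{Z})^\times$, $A+C=(\mathbb{Z}/p\mathbb{Z})^\times$, $B+B=\{0\}\cup A$, $B+C=A\cup C$, $C+C=\mathbb{Z}/p\mathbb{Z}$, and consequently the relations $R_X=\{(x,y)\in(\mathbb{Z}/113\mathbb{Z})^2 : y-x\in X\}$ for $X\in\{A,B,C\}$ (assigned to the atoms $a,b,c$ respectively) form a representation of the relation algebra $59_{65}$ over the finite set $\mathbb{Z}/113\mathbb{Z}$.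
   Context: $59_{65}$ is the finite integral symmetric relation algebra (numbered as in Maddux's book) with atoms $1'$, $a$, $b$, $c$, all symmetric, whose diversity cycles (up to permutation) are $aaa$, $acc$, $aab$, $aac$, $bcc$, $abc$, $ccc$, and for which $bbb$ and $cbb$ are not cycles. A representation over a set $U$ is a partition of $U\times U$ into the identity relation and nonempty symmetric relations $R_a,R_b,R_c$ such that for all $i,j,k\in\{a,b,c\}$ and all $(x,y)\in R_i$, there exists $z\in U$ with $(x,z)\in R_j$, $(z,y)\in R_k$ if and only if $ijk$ is a cycle. For subsets $X,Y\subseteq\mathbb{Z}/p\mathbb{Z}$, $X+Y=\{x+y:x\in X,y\in Y\}$, and $(\mathbb{Z}/p\mathbb{Z})^\times$ denotes the nonzero residues. -}

module Defs where

open import Data.Nat using (ℕ; zero; suc; _+_; _*_; _∸_; _^_; _<_; _%_)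
open import Data.Nat.DivMod using (m%n<n)
open import Data.Fin using (Fin; toℕ; fromℕ<)
open import Data.Product using (Σ; ∃; ∃-syntax; _×_; _,_)
open import Data.Sum using (_⊎_)
open import Data.Unit using (⊤)
open import Data.Empty using (⊥)
open import Relation.Nullary using (¬_)
open import Relation.Binary.PropositionalEquality using (_≡_; _≢_)
open import Function.Bundles using (_⇔_)

p : ℕ
p = 113

ZP : Set
ZP = Fin p

[_] : ℕ → ZP
[ n ] = fromℕ< (m%n<n n p)

_⊕_ : ZP → ZP → ZP
x ⊕ y = [ toℕ x + toℕ y ]

_⊖_ : ZP → ZP → ZP
y ⊖ x = [ toℕ y + (p ∸ toℕ x) ]

0ₚ : ZP
0ₚ = [ 0 ]

Subset : Set₁
Subset = ZP → Set

_≐_ : Subset → Subset → Set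
S ≐ T = ∀ z → (S z ⇔ T z)

_∪_ : Subset → Subset → Subset
(S ∪ T) z = S z ⊎ T z

_+ₛ_ : Subset → Subset → Subset
(X +ₛ Y) z = Σ ZP λ x → Σ ZP λ y → X x × Y y × z ≡ x ⊕ y

Full : Subset
Full _ = ⊤

Units : Subset
Units z = z ≢ 0ₚ

Zero : Subset
Zero z = z ≡ 0ₚ

m g : ℕ
m = 8
g = 3

X : ℕ → Subset
X i z = Σ ℕ λ α → α < 14 × z ≡ [ g ^ (m * α + i) ]

A B C : Subset
A = X 1 ∪ (X 2 ∪ (X 3 ∪ (X 4 ∪ X 5)))
B = X 0
C = X 6 ∪ X 7

-- The relation algebra 59_65 (diversity atoms a, b, c, all symmetric)

data Atom : Set where
  a b c : Atom

cnt : Atom → Atom → ℕ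
cnt a a = 1
cnt b b = 1
cnt c c = 1
cnt _ _ = 0

count : Atom → Atom → Atom → Atom → ℕ
count t i j k = cnt t i + cnt t j + cnt t k

-- Forbidden diversity triples (up to permutation): bbb and bbc.
-- Every other triple of diversity atoms is a cycle.
Forbidden : Atom → Atom → Atom → Set
Forbidden i j k = (count b i j k ≡ 3) ⊎ (count b i j k ≡ 2 × count c i j k ≡ 1)

Cycle : Atom → Atom → Atom → Set
Cycle i j k = ¬ Forbidden i j k

record IsRepresentation (U : Set) (R : Atom → U → U → Set) : Set₁ where
  field
    -- partition of U × U into identity, R a, R b, R c
    diag-disjoint : ∀ i x y → R i x y → x ≢ y
    covers        : ∀ x y → x ≢ y → Σ Atom λ i → R i x y
    disjoint      : ∀ i j x y → R i x y → R j x y → i ≡ j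
    nonempty      : ∀ i → Σ U λ x → Σ U λ y → R i x y
    symmetric     : ∀ i x y → R i x y → R i y x
    cycles        : ∀ i j k x y → R i x y →
                      ((Σ U λ z → R j x z × R k z y) ⇔ Cycle i j k)

Rel : Subset → ZP → ZP → Set
Rel S x y = S (y ⊖ x)

atomSet : Atom → Subset
atomSet a = A
atomSet b = B
atomSet c = C

R : Atom → ZP → ZP → Set
R i = Rel (atomSet i)

module Submission where

-- The sets A = X₁ ∪ … ∪ X₅, B = X₀, C = X₆ ∪ X₇ are unions of cyclotomic
-- classes, and every statement of the theorem is a finite assertion about
-- ℤ/113ℤ.  The proof reduces each of them to a decision procedure that the
-- type checker runs:
--   * ⊕ and ⊖ form an abelian group on ℤ/pℤ; from this, y ∈ S + Y iff some
--     x ∈ S has y ⊖ x ∈ Y, and paths x → z → y through R_S and R_Y correspond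
--     exactly to decompositions of y ⊖ x in S + Y.  Hence the composition
--     condition for the relations R_S reduces to sumsets of the atom sets.
--   * A table `class` records the cyclotomic class of each residue; checking it
--     once against the definition of X i shows X i z ⇔ class z ≡ i, which makes
--     membership in A, B, C decidable by a table lookup.
--   * The six sumset identities, and the finite facts about the atom sets
--     (partition, symmetry, composition table) are then decided exhaustively,
--     and the representation of 59₆₅ is assembled from them.

open import Defs
open import Data.Nat using (ℕ; _+_; _*_; _^_; _∸_; _<_; _%_; _<?_)
open import Data.Nat.Properties using (+-assoc; +-comm; m+[n∸m]≡n; <⇒≤; <-irrefl; anyUpTo?; allUpTo?)
import Data.Nat.Properties as ℕ
open import Data.Nat.DivMod using (m%n<n; m<n⇒m%n≡m; %-distribˡ-+)
open import Data.Fin using (toℕ) renaming (_≟_ to _≟ₚ_)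
open import Data.Fin.Properties using (toℕ-injective; toℕ<n; toℕ-fromℕ<; all?; any?)
open import Data.Vec using (Vec; lookup; _∷_; [])
open import Data.List using (List; _∷_; [])
open import Data.List.Relation.Unary.All as All using (All; _∷_)
open import Data.List.Relation.Unary.Any using (here; there)
open import Data.List.Membership.Propositional using (_∈_)
open import Data.List.Membership.DecPropositional ℕ._≟_ using (_∈?_)
open import Data.Product using (Σ; _×_; _,_)
open import Data.Sum using (_⊎_; inj₁; inj₂)
open import Data.Empty using (⊥; ⊥-elim)
open import Data.Unit using (tt)
open import Function using (_∘_)
open import Function.Bundles using (_⇔_; mk⇔; Equivalence)
open import Function.Construct.Symmetry using (⇔-sym)
open import Function.Construct.Composition using (_⇔-∘_)
open import Relation.Nullary using (Dec; ¬_; ¬?; _×-dec_; _⊎-dec_; _→-dec_; map′; from-yes)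
import Relation.Nullary.Decidable as Dec
open import Relation.Unary using (Decidable)
open import Relation.Binary.PropositionalEquality
  using (_≡_; _≢_; refl; sym; trans; cong; cong₂; subst; module ≡-Reasoning)

open ≡-Reasoning
open Equivalence using (to; from)

toℕ-[] : ∀ n → toℕ [ n ] ≡ n % p
toℕ-[] n = toℕ-fromℕ< (m%n<n n p)

[]-≡ : ∀ m n → m % p ≡ n % p → [ m ] ≡ [ n ]
[]-≡ m n e = toℕ-injective (trans (toℕ-[] m) (trans e (sym (toℕ-[] n))))

[]-toℕ : ∀ x → [ toℕ x ] ≡ x
[]-toℕ x = toℕ-injective (trans (toℕ-[] (toℕ x)) (m<n⇒m%n≡m (toℕ<n x)))

[]-+ : ∀ m n → [ m ] ⊕ [ n ] ≡ [ m + n ]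
[]-+ m n = []-≡ (toℕ [ m ] + toℕ [ n ]) (m + n) (begin
  (toℕ [ m ] + toℕ [ n ]) % p ≡⟨ cong₂ (λ s t → (s + t) % p) (toℕ-[] m) (toℕ-[] n) ⟩
  (m % p + n % p) % p         ≡⟨ sym (%-distribˡ-+ m n p) ⟩
  (m + n) % p                 ∎)

-ₚ_ : ZP → ZP
-ₚ x = [ p ∸ toℕ x ]

⊕-comm : ∀ x y → x ⊕ y ≡ y ⊕ x
⊕-comm x y = cong [_] (+-comm (toℕ x) (toℕ y))

⊕-assoc : ∀ x y z → (x ⊕ y) ⊕ z ≡ x ⊕ (y ⊕ z)
⊕-assoc x y z = begin
  (x ⊕ y) ⊕ z                       ≡⟨ cong ((x ⊕ y) ⊕_) (sym ([]-toℕ z)) ⟩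
  [ toℕ x + toℕ y ] ⊕ [ toℕ z ]     ≡⟨ []-+ (toℕ x + toℕ y) (toℕ z) ⟩
  [ toℕ x + toℕ y + toℕ z ]         ≡⟨ cong [_] (+-assoc (toℕ x) (toℕ y) (toℕ z)) ⟩
  [ toℕ x + (toℕ y + toℕ z) ]       ≡⟨ sym ([]-+ (toℕ x) (toℕ y + toℕ z)) ⟩
  [ toℕ x ] ⊕ (y ⊕ z)               ≡⟨ cong (_⊕ (y ⊕ z)) ([]-toℕ x) ⟩
  x ⊕ (y ⊕ z)                       ∎

⊕-identityˡ : ∀ x → 0ₚ ⊕ x ≡ x
⊕-identityˡ = []-toℕ

⊕-identityʳ : ∀ x → x ⊕ 0ₚ ≡ x
⊕-identityʳ x = trans (⊕-comm x 0ₚ) (⊕-identityˡ x)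

⊕-inverseʳ : ∀ x → x ⊕ (-ₚ x) ≡ 0ₚ
⊕-inverseʳ x = begin
  x ⊕ (-ₚ x)                   ≡⟨ cong (_⊕ (-ₚ x)) (sym ([]-toℕ x)) ⟩
  [ toℕ x ] ⊕ [ p ∸ toℕ x ]    ≡⟨ []-+ (toℕ x) (p ∸ toℕ x) ⟩
  [ toℕ x + (p ∸ toℕ x) ]      ≡⟨ cong [_] (m+[n∸m]≡n (<⇒≤ (toℕ<n x))) ⟩
  [ p ]                        ≡⟨⟩
  0ₚ                           ∎

⊖-as-⊕ : ∀ y x → y ⊖ x ≡ y ⊕ (-ₚ x)
⊖-as-⊕ y x = begin
  [ toℕ y + (p ∸ toℕ x) ]      ≡⟨ sym ([]-+ (toℕ y) (p ∸ toℕ x)) ⟩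
  [ toℕ y ] ⊕ (-ₚ x)           ≡⟨ cong (_⊕ (-ₚ x)) ([]-toℕ y) ⟩
  y ⊕ (-ₚ x)                   ∎

⊕-⊖-cancel : ∀ x y → x ⊕ (y ⊖ x) ≡ y
⊕-⊖-cancel x y = begin
  x ⊕ (y ⊖ x)        ≡⟨ cong (x ⊕_) (trans (⊖-as-⊕ y x) (⊕-comm y (-ₚ x))) ⟩
  x ⊕ ((-ₚ x) ⊕ y)   ≡⟨ sym (⊕-assoc x (-ₚ x) y) ⟩
  (x ⊕ (-ₚ x)) ⊕ y   ≡⟨ cong (_⊕ y) (⊕-inverseʳ x) ⟩
  0ₚ ⊕ y             ≡⟨ ⊕-identityˡ y ⟩
  y                  ∎

⊖-unique : ∀ x w y → x ⊕ w ≡ y → w ≡ y ⊖ x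
⊖-unique x w y x⊕w≡y = begin
  w                    ≡⟨ sym (⊕-identityˡ w) ⟩
  0ₚ ⊕ w               ≡⟨ cong (_⊕ w) (sym (trans (⊕-comm (-ₚ x) x) (⊕-inverseʳ x))) ⟩
  ((-ₚ x) ⊕ x) ⊕ w     ≡⟨ ⊕-assoc (-ₚ x) x w ⟩
  (-ₚ x) ⊕ (x ⊕ w)     ≡⟨ cong ((-ₚ x) ⊕_) x⊕w≡y ⟩
  (-ₚ x) ⊕ y           ≡⟨ ⊕-comm (-ₚ x) y ⟩
  y ⊕ (-ₚ x)           ≡⟨ sym (⊖-as-⊕ y x) ⟩
  y ⊖ x                ∎

⊖-self : ∀ x → x ⊖ x ≡ 0ₚ
⊖-self x = trans (⊖-as-⊕ x x) (⊕-inverseʳ x)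

⊖-identityʳ : ∀ x → x ⊖ 0ₚ ≡ x
⊖-identityʳ x = sym (⊖-unique 0ₚ x x (⊕-identityˡ x))

⊖≡0⇒≡ : ∀ x y → y ⊖ x ≡ 0ₚ → x ≡ y
⊖≡0⇒≡ x y e = begin
  x                ≡⟨ sym (⊕-identityʳ x) ⟩
  x ⊕ 0ₚ           ≡⟨ cong (x ⊕_) (sym e) ⟩
  x ⊕ (y ⊖ x)      ≡⟨ ⊕-⊖-cancel x y ⟩
  y                ∎

⊖-triangle : ∀ x y z → (z ⊖ x) ⊕ (y ⊖ z) ≡ y ⊖ x
⊖-triangle x y z = ⊖-unique x _ y (begin
  x ⊕ ((z ⊖ x) ⊕ (y ⊖ z))   ≡⟨ sym (⊕-assoc x (z ⊖ x) (y ⊖ z)) ⟩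
  (x ⊕ (z ⊖ x)) ⊕ (y ⊖ z)   ≡⟨ cong (_⊕ (y ⊖ z)) (⊕-⊖-cancel x z) ⟩
  z ⊕ (y ⊖ z)               ≡⟨ ⊕-⊖-cancel z y ⟩
  y                         ∎)

⊖-swap : ∀ x y → x ⊖ y ≡ 0ₚ ⊖ (y ⊖ x)
⊖-swap x y = ⊖-unique (y ⊖ x) (x ⊖ y) 0ₚ (trans (⊖-triangle x x y) (⊖-self x))

+ₛ⇔ : ∀ (S Y : Subset) d → (S +ₛ Y) d ⇔ (Σ ZP λ x → S x × Y (d ⊖ x))
+ₛ⇔ S Y d = mk⇔
  (λ { (x , y , x∈S , y∈Y , d≡x⊕y) → x , x∈S , subst Y (⊖-unique x y d (sym d≡x⊕y)) y∈Y })
  (λ { (x , x∈S , d⊖x∈Y) → x , d ⊖ x , x∈S , d⊖x∈Y , sym (⊕-⊖-cancel x d) })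

path⇔+ₛ : ∀ (S Y : Subset) x y → (Σ ZP λ z → Rel S x z × Rel Y z y) ⇔ (S +ₛ Y) (y ⊖ x)
path⇔+ₛ S Y x y = mk⇔
  (λ { (z , xSz , zYy) → z ⊖ x , y ⊖ z , xSz , zYy , sym (⊖-triangle x y z) })
  (λ { (u , v , u∈S , v∈Y , y⊖x≡u⊕v) →
         x ⊕ u , subst S (⊖-unique x u _ refl) u∈S
               , subst Y (⊖-unique (x ⊕ u) v y (begin
                   (x ⊕ u) ⊕ v   ≡⟨ ⊕-assoc x u v ⟩
                   x ⊕ (u ⊕ v)   ≡⟨ cong (x ⊕_) (sym y⊖x≡u⊕v) ⟩
                   x ⊕ (y ⊖ x)   ≡⟨ ⊕-⊖-cancel x y ⟩
                   y             ∎)) v∈Y })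

_⇔?_ : {P Q : Set} → Dec P → Dec Q → Dec (P ⇔ Q)
P? ⇔? Q? = map′ (λ { (P⇒Q , Q⇒P) → mk⇔ P⇒Q Q⇒P }) (λ P⇔Q → to P⇔Q , from P⇔Q)
  ((P? →-dec Q?) ×-dec (Q? →-dec P?))

_+?_ : {S Y : Subset} → Decidable S → Decidable Y → Decidable (S +ₛ Y)
(S? +? Y?) d = Dec.map (⇔-sym (+ₛ⇔ _ _ d)) (any? λ x → S? x ×-dec Y? (d ⊖ x))

_≐?_ : {S T : Subset} → Decidable S → Decidable T → Dec (S ≐ T)
S? ≐? T? = all? λ z → S? z ⇔? T? z

_∪?_ : {S T : Subset} → Decidable S → Decidable T → Decidable (S ∪ T)
(S? ∪? T?) z = S? z ⊎-dec T? z

Full? : Decidable Full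
Full? _ = Dec.yes tt

Units? : Decidable Units
Units? z = ¬? (z ≟ₚ 0ₚ)

Zero? : Decidable Zero
Zero? z = z ≟ₚ 0ₚ

∀-atom? : {P : Atom → Set} → (∀ i → Dec (P i)) → Dec (∀ i → P i)
∀-atom? P? = map′
  (λ { (pa , pb , pc) → λ { a → pa ; b → pb ; c → pc } })
  (λ ∀P → ∀P a , ∀P b , ∀P c)
  (P? a ×-dec P? b ×-dec P? c)

∃-atom? : {P : Atom → Set} → (∀ i → Dec (P i)) → Dec (Σ Atom P)
∃-atom? P? = map′
  (λ { (inj₁ pa) → a , pa ; (inj₂ (inj₁ pb)) → b , pb ; (inj₂ (inj₂ pc)) → c , pc })
  (λ { (a , pa) → inj₁ pa ; (b , pb) → inj₂ (inj₁ pb) ; (c , pc) → inj₂ (inj₂ pc) })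
  (P? a ⊎-dec P? b ⊎-dec P? c)

_≟ₐ_ : (i j : Atom) → Dec (i ≡ j)
a ≟ₐ a = Dec.yes refl
b ≟ₐ b = Dec.yes refl
c ≟ₐ c = Dec.yes refl
a ≟ₐ b = Dec.no λ ()
a ≟ₐ c = Dec.no λ ()
b ≟ₐ a = Dec.no λ ()
b ≟ₐ c = Dec.no λ ()
c ≟ₐ a = Dec.no λ ()
c ≟ₐ b = Dec.no λ ()

cycle? : ∀ i j k → Dec (Cycle i j k)
cycle? i j k = ¬? ((count b i j k ℕ.≟ 3) ⊎-dec ((count b i j k ℕ.≟ 2) ×-dec (count c i j k ℕ.≟ 1)))

-- classTable z is the index i with z ∈ X i, and 8 for z = 0.
classTable : Vec ℕ p
classTable =
  8 ∷ 0 ∷ 4 ∷ 1 ∷ 0 ∷ 3 ∷ 5 ∷ 0 ∷ 4 ∷ 2 ∷ 7 ∷ 2 ∷ 1 ∷ 6 ∷ 4 ∷ 4 ∷ 0 ∷ 5 ∷ 6 ∷ 3 ∷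
  3 ∷ 1 ∷ 6 ∷ 1 ∷ 5 ∷ 6 ∷ 2 ∷ 3 ∷ 0 ∷ 1 ∷ 0 ∷ 2 ∷ 4 ∷ 3 ∷ 1 ∷ 3 ∷ 2 ∷ 3 ∷ 7 ∷ 7 ∷
  7 ∷ 6 ∷ 5 ∷ 7 ∷ 2 ∷ 5 ∷ 5 ∷ 7 ∷ 1 ∷ 0 ∷ 2 ∷ 6 ∷ 6 ∷ 4 ∷ 7 ∷ 5 ∷ 4 ∷ 4 ∷ 5 ∷ 7 ∷
  4 ∷ 6 ∷ 6 ∷ 2 ∷ 0 ∷ 1 ∷ 7 ∷ 5 ∷ 5 ∷ 2 ∷ 7 ∷ 5 ∷ 6 ∷ 7 ∷ 7 ∷ 7 ∷ 3 ∷ 2 ∷ 3 ∷ 1 ∷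
  3 ∷ 4 ∷ 2 ∷ 0 ∷ 1 ∷ 0 ∷ 3 ∷ 2 ∷ 6 ∷ 5 ∷ 1 ∷ 6 ∷ 1 ∷ 3 ∷ 3 ∷ 6 ∷ 5 ∷ 0 ∷ 4 ∷ 4 ∷
  6 ∷ 1 ∷ 2 ∷ 7 ∷ 2 ∷ 4 ∷ 0 ∷ 5 ∷ 3 ∷ 0 ∷ 1 ∷ 4 ∷ 0 ∷ []

class : ZP → ℕ
class = lookup classTable

≡[]⇔ : ∀ z n → (z ≡ [ n ]) ⇔ (toℕ z ≡ n % p)
≡[]⇔ z n = mk⇔
  (λ { refl → toℕ-[] n })
  (λ toℕz≡n%p → trans (sym ([]-toℕ z)) ([]-≡ (toℕ z) n (trans (m<n⇒m%n≡m (toℕ<n z)) toℕz≡n%p)))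

X? : ∀ i → Decidable (X i)
X? i z = anyUpTo? (λ α → Dec.map (⇔-sym (≡[]⇔ z (g ^ (m * α + i)))) (toℕ z ℕ.≟ g ^ (m * α + i) % p)) 14

class-of-member : ∀ {i} → i < m → ∀ {α} → α < 14 → class [ g ^ (m * α + i) ] ≡ i
class-of-member = from-yes
  (allUpTo? (λ i → allUpTo? (λ α → class [ g ^ (m * α + i) ] ℕ.≟ i) 14) m)

zero-or-classified : ∀ z → z ≡ 0ₚ ⊎ X (class z) z
zero-or-classified = from-yes (all? λ z → (z ≟ₚ 0ₚ) ⊎-dec X? (class z) z)

X⇔class : ∀ {i} → i < m → ∀ z → X i z ⇔ class z ≡ i
X⇔class {i} i<m z = mk⇔ member⇒class class⇒member
  where
  member⇒class : X i z → class z ≡ i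
  member⇒class (α , α<14 , refl) = class-of-member i<m α<14

  class⇒member : class z ≡ i → X i z
  class⇒member classz≡i = classified (zero-or-classified z)
    where
    classified : z ≡ 0ₚ ⊎ X (class z) z → X i z
    classified (inj₁ refl) = ⊥-elim (<-irrefl (sym classz≡i) i<m)
    classified (inj₂ z∈X)  = subst (λ k → X k z) classz≡i z∈X

Classes : List ℕ → Subset
Classes []              = λ _ → ⊥
Classes (i ∷ [])        = X i
Classes (i ∷ is@(_ ∷ _)) = X i ∪ Classes is

Classes⇔ : ∀ is → All (_< m) is → ∀ z → Classes is z ⇔ class z ∈ is
Classes⇔ [] _ z = mk⇔ ⊥-elim (λ ())
Classes⇔ (i ∷ []) (i<m ∷ _) z = mk⇔
  (here ∘ to (X⇔class i<m z))
  (λ { (here e) → from (X⇔class i<m z) e ; (there ()) })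
Classes⇔ (i ∷ is@(_ ∷ _)) (i<m ∷ is<m) z = mk⇔
  (λ { (inj₁ z∈Xi) → here (to (X⇔class i<m z) z∈Xi)
     ; (inj₂ z∈Xis) → there (to (Classes⇔ is is<m z) z∈Xis) })
  (λ { (here e) → inj₁ (from (X⇔class i<m z) e)
     ; (there e) → inj₂ (from (Classes⇔ is is<m z) e) })

atomClasses : Atom → List ℕ
atomClasses a = 1 ∷ 2 ∷ 3 ∷ 4 ∷ 5 ∷ []
atomClasses b = 0 ∷ []
atomClasses c = 6 ∷ 7 ∷ []

atomClasses-bounded : ∀ i → All (_< m) (atomClasses i)
atomClasses-bounded = from-yes (∀-atom? λ i → All.all? (_<? m) (atomClasses i))

atomSet⇔ : ∀ i z → atomSet i z ⇔ class z ∈ atomClasses i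
atomSet⇔ a = Classes⇔ (atomClasses a) (atomClasses-bounded a)
atomSet⇔ b = Classes⇔ (atomClasses b) (atomClasses-bounded b)
atomSet⇔ c = Classes⇔ (atomClasses c) (atomClasses-bounded c)



atom? : ∀ i → Decidable (atomSet i)
atom? i z = Dec.map (⇔-sym (atomSet⇔ i z)) (class z ∈? atomClasses i)

A+A≐Full : (A +ₛ A) ≐ Full
A+A≐Full = from-yes ((atom? a +? atom? a) ≐? Full?)

A+B≐Units : (A +ₛ B) ≐ Units
A+B≐Units = from-yes ((atom? a +? atom? b) ≐? Units?)

A+C≐Units : (A +ₛ C) ≐ Units
A+C≐Units = from-yes ((atom? a +? atom? c) ≐? Units?)

B+B≐0∪A : (B +ₛ B) ≐ (Zero ∪ A)
B+B≐0∪A = from-yes ((atom? b +? atom? b) ≐? (Zero? ∪? atom? a))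

B+C≐A∪C : (B +ₛ C) ≐ (A ∪ C)
B+C≐A∪C = from-yes ((atom? b +? atom? c) ≐? (atom? a ∪? atom? c))

C+C≐Full : (C +ₛ C) ≐ Full
C+C≐Full = from-yes ((atom? c +? atom? c) ≐? Full?)

zero-in-no-atom : ∀ i → ¬ atomSet i 0ₚ
zero-in-no-atom = from-yes (∀-atom? λ i → ¬? (atom? i 0ₚ))

atoms-cover : ∀ d → d ≡ 0ₚ ⊎ Σ Atom (λ i → atomSet i d)
atoms-cover = from-yes (all? λ d → d ≟ₚ 0ₚ ⊎-dec ∃-atom? (λ i → atom? i d))

atoms-disjoint : ∀ i j d → atomSet i d → atomSet j d → i ≡ j
atoms-disjoint = from-yes
  (∀-atom? λ i → ∀-atom? λ j → all? λ d → atom? i d →-dec (atom? j d →-dec (i ≟ₐ j)))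

atoms-nonempty : ∀ i → Σ ZP (atomSet i)
atoms-nonempty = from-yes (∀-atom? λ i → any? (atom? i))

atoms-symmetric : ∀ i d → atomSet i d → atomSet i (0ₚ ⊖ d)
atoms-symmetric = from-yes (∀-atom? λ i → all? λ d → atom? i d →-dec atom? i (0ₚ ⊖ d))

composition-table : ∀ i j k d → atomSet i d → ((atomSet j +ₛ atomSet k) d ⇔ Cycle i j k)
composition-table = from-yes
  (∀-atom? λ i → ∀-atom? λ j → ∀-atom? λ k → all? λ d →
     atom? i d →-dec ((atom? j +? atom? k) d ⇔? cycle? i j k))

representation : IsRepresentation ZP R
representation = record
  { diag-disjoint = irreflexive
  ; covers        = total
  ; disjoint      = λ i j x y → atoms-disjoint i j (y ⊖ x)
  ; nonempty      = nonempty
  ; symmetric     = symmetric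
  ; cycles        = λ i j k x y xRy →
      composition-table i j k (y ⊖ x) xRy ⇔-∘ path⇔+ₛ (atomSet j) (atomSet k) x y
  }
  where
  irreflexive : ∀ i x y → R i x y → x ≢ y
  irreflexive i x .x xRx refl = zero-in-no-atom i (subst (atomSet i) (⊖-self x) xRx)

  total : ∀ x y → x ≢ y → Σ Atom λ i → R i x y
  total x y x≢y = classify (atoms-cover (y ⊖ x))
    where
    classify : y ⊖ x ≡ 0ₚ ⊎ Σ Atom (λ i → atomSet i (y ⊖ x)) → Σ Atom λ i → R i x y
    classify (inj₁ y⊖x≡0) = ⊥-elim (x≢y (⊖≡0⇒≡ x y y⊖x≡0))
    classify (inj₂ atom)  = atom

  nonempty : ∀ i → Σ ZP λ x → Σ ZP λ y → R i x y
  nonempty i = from-origin (atoms-nonempty i)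
    where
    from-origin : Σ ZP (atomSet i) → Σ ZP λ x → Σ ZP λ y → R i x y
    from-origin (d , d∈i) = 0ₚ , d , subst (atomSet i) (sym (⊖-identityʳ d)) d∈i

  symmetric : ∀ i x y → R i x y → R i y x
  symmetric i x y xRy = subst (atomSet i) (sym (⊖-swap x y)) (atoms-symmetric i (y ⊖ x) xRy)

mainTheorem3 : ((A +ₛ A) ≐ Full)
               × ((A +ₛ B) ≐ Units)
               × ((A +ₛ C) ≐ Units)
               × ((B +ₛ B) ≐ (Zero ∪ A))
               × ((B +ₛ C) ≐ (A ∪ C))
               × ((C +ₛ C) ≐ Full)
               × IsRepresentation ZP R
mainTheorem3 =
  A+A≐Full , A+B≐Units , A+C≐Units , B+B≐0∪A , B+C≐A∪C , C+C≐Full , representation
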